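{- Let $A$ be a forest automaton and let $\psi$ be a live trace property for $A$. Then there exists a set $L$ of complemented pairs over $A$ such that $(A,L)$ is a live automaton and $\mathit{traces}(\mathit{lexecs}(A,L))=\psi$.
   Context: An automaton $A$ has a set of states $\mathit{states}(A)$, nonempty start states, disjoint external and internal actions, and a transition relation $\mathit{steps}(A)\subseteq\mathit{states}(A)\times\mathit{acts}(A)\times\mathit{states}(A)$. An execution is a finite or infinite alternating sequence $s_0a_1s_1\ldots$ starting in a start state with each $(s_i,a_{i+1},s_{i+1})\in\mathit{steps}(A)$ (ending in a state if finite); $\alpha<\alpha'$ means proper prefix; $\mathit{execs}^\omega(A)$ is the set of infinite executions. The trace of an execution is its sequence of external actions; $\mathit{traces}(X)$ is the set of traces of executions in $X$. $A$ is a forest automaton if for each reachable state $s$ there is exactly one finite execution with last state $s$. A live execution property is a set $\varphi\subseteq\mathit{execs}^\omega(A)$ such that every finite execution has a proper extension in $\varphi$; a live trace property is a set of the form $\mathit{traces}(\varphi)$ with $\varphi$ a live execution property. A complemented pair is $p=\langle p.\mathsf{R},p.\mathsf{G}\rangle$ with $p.\mathsf{R},p.\mathsf{G}\subseteq\mathit{states}(A)$; an infinite execution satisfies $p$ iff, if infinitely many of its positions carry states in $p.\mathsf{R}$, then infinitely many carry states in $p.\mathsf{G}$. $(A,L)$ is a live automaton if $L$ is a set (any cardinality) of complemented pairs such that each finite execution has a proper infinite extension execution satisfying all pairs of $L$; $\mathit{lexecs}(A,L)$ is the set of infinite executions satisfying every pair in $L$. -}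

module Defs where

open import Data.Nat using (ℕ; zero; suc; _≤_; _+_)
open import Data.Sum using (_⊎_; inj₁; inj₂)
open import Data.Product using (Σ; ∃; _×_; _,_)
open import Data.List using (List; []; _∷_)
open import Data.Maybe using (Maybe; just; nothing)
open import Data.Unit using (⊤)
open import Relation.Binary.PropositionalEquality using (_≡_)
open import Function.Bundles using (_⇔_)

record Automaton : Set₁ where
  field
    State    : Set
    Ext      : Set
    Int      : Set
    Start    : State → Set
    startNE  : ∃ Start
    Step     : State → (Ext ⊎ Int) → State → Set

  Act : Set
  Act = Ext ⊎ Int

module _ (A : Automaton) where
  open Automaton A

  record FinSeq : Set where
    constructor ⟨_,_⟩
    field
      first : State
      rest  : List (Act × State)

  lastFrom : State → List (Act × State) → State
  lastFrom s []             = s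
  lastFrom s ((a , s') ∷ l) = lastFrom s' l

  lastState : FinSeq → State
  lastState ⟨ s , l ⟩ = lastFrom s l

  Chain : State → List (Act × State) → Set
  Chain s []             = ⊤
  Chain s ((a , s') ∷ l) = Step s a s' × Chain s' l

  IsFinExec : FinSeq → Set
  IsFinExec ⟨ s , l ⟩ = Start s × Chain s l

  Reachable : State → Set
  Reachable s = Σ FinSeq λ α → IsFinExec α × lastState α ≡ s

  IsForest : Set
  IsForest = ∀ s → Reachable s →
    Σ FinSeq λ α → (IsFinExec α × lastState α ≡ s) ×
      (∀ β → IsFinExec β → lastState β ≡ s → β ≡ α)

  -- Infinite executions s₀ a₁ s₁ a₂ s₂ … : st i = sᵢ, ac i = aᵢ₊₁.
  record InfSeq : Set where
    field
      st : ℕ → State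
      ac : ℕ → Act
  open InfSeq public

  IsInfExec : InfSeq → Set
  IsInfExec β = Start (st β 0) × (∀ i → Step (st β i) (ac β i) (st β (suc i)))

  MatchFrom : List (Act × State) → InfSeq → ℕ → Set
  MatchFrom []             β i = ⊤
  MatchFrom ((a , s) ∷ l)  β i = ac β i ≡ a × st β (suc i) ≡ s × MatchFrom l β (suc i)

  _≺_ : FinSeq → InfSeq → Set
  ⟨ s , l ⟩ ≺ β = st β 0 ≡ s × MatchFrom l β 0

  -- A trace (finite or infinite sequence of external actions) is
  -- represented as t : ℕ → Maybe Ext, t k = just e meaning the k-th
  -- (0-based) external action is e, t k = nothing meaning there are at most
  -- k external actions.
  Trace : Set
  Trace = ℕ → Maybe Ext

  isExt : Act → ℕ
  isExt (inj₁ _) = 1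
  isExt (inj₂ _) = 0

  extCount : InfSeq → ℕ → ℕ
  extCount β zero    = zero
  extCount β (suc i) = isExt (ac β i) + extCount β i

  IsTraceOf : InfSeq → Trace → Set
  IsTraceOf β t = ∀ k e →
    (t k ≡ just e) ⇔ (Σ ℕ λ i → ac β i ≡ inj₁ e × extCount β i ≡ k)

  traces : (InfSeq → Set) → Trace → Set
  traces X t = Σ InfSeq λ β → X β × IsTraceOf β t

  IsLiveExecProp : (InfSeq → Set) → Set
  IsLiveExecProp φ = (∀ β → φ β → IsInfExec β) ×
    (∀ α → IsFinExec α → Σ InfSeq λ β → φ β × α ≺ β)

  IsLiveTraceProp : (Trace → Set) → Set₁
  IsLiveTraceProp ψ = Σ (InfSeq → Set) λ φ → IsLiveExecProp φ × (∀ t → ψ t ⇔ traces φ t)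

  record CPair : Set₁ where
    field
      R : State → Set
      G : State → Set
  open CPair public

  InfOften : (ℕ → Set) → Set
  InfOften P = ∀ n → Σ ℕ λ i → n ≤ i × P i

  SatPair : InfSeq → CPair → Set
  SatPair β p = InfOften (λ i → R p (st β i)) → InfOften (λ i → G p (st β i))

  SatAll : InfSeq → (CPair → Set) → Set₁
  SatAll β L = ∀ p → L p → SatPair β p

  IsLiveAutomaton : (CPair → Set) → Set₁
  IsLiveAutomaton L = ∀ α → IsFinExec α →
    Σ InfSeq λ β → IsInfExec β × α ≺ β × SatAll β L

  lexecs : (CPair → Set) → InfSeq → Set₁
  lexecs L β = IsInfExec β × SatAll β L

  traces₁ : (InfSeq → Set₁) → Trace → Set₁
  traces₁ X t = Σ InfSeq λ β → X β × IsTraceOf β t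

-- Take one complemented pair per infinite execution β: its R-set is the set of
-- states visited by β, and its G-set is everything if β is (up to pointwise
-- equality) in φ and nothing otherwise.  In a forest automaton every state
-- determines the finite execution leading to it, so an infinite execution that
-- visits states of β infinitely often coincides with β.  Hence an execution in φ
-- satisfies every pair (it can only trigger the R-set of itself), while an
-- execution outside φ violates its own pair.
module Submission where

open import Defs
open import Data.Product using (Σ; _×_; _,_; proj₁; proj₂)
open import Function.Bundles using (_⇔_; mk⇔; Equivalence)
open import Data.Nat using (ℕ; zero; suc; _+_; _<_; s≤s)
open import Data.Nat.Properties using (+-identityʳ; +-suc; ≤-refl)
open import Data.List using (List; []; _∷_)
open import Data.List.Properties using (∷-injective)
open import Data.Unit using (tt)
open import Relation.Binary.PropositionalEquality
  using (_≡_; refl; sym; trans; cong; cong₂; subst)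

module _ (A : Automaton) where
  open Automaton A

  stepsFrom : InfSeq A → ℕ → ℕ → List (Act × State)
  stepsFrom β i zero    = []
  stepsFrom β i (suc n) = (ac β i , st β (suc i)) ∷ stepsFrom β (suc i) n

  prefix : InfSeq A → ℕ → FinSeq A
  prefix β n = ⟨ st β 0 , stepsFrom β 0 n ⟩

  chain-stepsFrom : ∀ β → IsInfExec A β → ∀ i n → Chain A (st β i) (stepsFrom β i n)
  chain-stepsFrom β β-exec i zero    = tt
  chain-stepsFrom β β-exec i (suc n) = proj₂ β-exec i , chain-stepsFrom β β-exec (suc i) n

  prefix-isFinExec : ∀ β → IsInfExec A β → ∀ n → IsFinExec A (prefix β n)
  prefix-isFinExec β β-exec n = proj₁ β-exec , chain-stepsFrom β β-exec 0 n

  lastFrom-stepsFrom : ∀ β i n → lastFrom A (st β i) (stepsFrom β i n) ≡ st β (n + i)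
  lastFrom-stepsFrom β i zero    = refl
  lastFrom-stepsFrom β i (suc n) =
    trans (lastFrom-stepsFrom β (suc i) n) (cong (st β) (+-suc n i))

  lastState-prefix : ∀ β n → lastState A (prefix β n) ≡ st β n
  lastState-prefix β n = trans (lastFrom-stepsFrom β 0 n) (cong (st β) (+-identityʳ n))

  StepAgrees : InfSeq A → InfSeq A → ℕ → Set
  StepAgrees β γ k = ac β k ≡ ac γ k × st β (suc k) ≡ st γ (suc k)

  stepsFrom-≡⇒stepAgrees : ∀ β γ i m n → stepsFrom β i m ≡ stepsFrom γ i n →
    ∀ k → k < m → StepAgrees β γ (k + i)
  stepsFrom-≡⇒stepAgrees β γ i (suc m) (suc n) eq zero _ =
    cong proj₁ head≡ , cong proj₂ head≡
    where
      head≡ : (ac β i , st β (suc i)) ≡ (ac γ i , st γ (suc i))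
      head≡ = proj₁ (∷-injective eq)
  stepsFrom-≡⇒stepAgrees β γ i (suc m) (suc n) eq (suc k) (s≤s k<m)
    rewrite sym (+-suc k i) =
    stepsFrom-≡⇒stepAgrees β γ (suc i) m n (proj₂ (∷-injective eq)) k k<m

  prefix-≡⇒stepAgrees : ∀ β γ m n → prefix β m ≡ prefix γ n → ∀ k → k < m → StepAgrees β γ k
  prefix-≡⇒stepAgrees β γ m n eq k k<m =
    subst (StepAgrees β γ) (+-identityʳ k)
      (stepsFrom-≡⇒stepAgrees β γ 0 m n (cong FinSeq.rest eq) k k<m)

  infix 4 _≋_
  _≋_ : InfSeq A → InfSeq A → Set
  β ≋ γ = (∀ i → st β i ≡ st γ i) × (∀ i → ac β i ≡ ac γ i)

  Visits : InfSeq A → State → Set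
  Visits β s = Σ ℕ λ i → st β i ≡ s

  forest-finExec-unique : IsForest A → ∀ α α′ → IsFinExec A α → IsFinExec A α′ →
    lastState A α ≡ lastState A α′ → α ≡ α′
  forest-finExec-unique forest α α′ α-exec α′-exec same-last
    with forest (lastState A α′) (α′ , α′-exec , refl)
  ... | _ , _ , unique = trans (unique α α-exec same-last) (sym (unique α′ α′-exec refl))

  forest-prefix-unique : IsForest A → ∀ β γ → IsInfExec A β → IsInfExec A γ →
    ∀ m n → st β m ≡ st γ n → prefix β m ≡ prefix γ n
  forest-prefix-unique forest β γ β-exec γ-exec m n same-last =
    forest-finExec-unique forest (prefix β m) (prefix γ n)
      (prefix-isFinExec β β-exec m) (prefix-isFinExec γ γ-exec n)
      (trans (lastState-prefix β m) (trans same-last (sym (lastState-prefix γ n))))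

  forest-≋ : IsForest A → ∀ β γ → IsInfExec A β → IsInfExec A γ →
    InfOften A (λ j → Visits γ (st β j)) → β ≋ γ
  forest-≋ forest β γ β-exec γ-exec often = st≡ , λ k → proj₁ (agrees k)
    where
      agrees : ∀ k → StepAgrees β γ k
      agrees k with often (suc k)
      ... | m , k<m , n , γₙ≡βₘ =
        prefix-≡⇒stepAgrees β γ m n
          (forest-prefix-unique forest β γ β-exec γ-exec m n (sym γₙ≡βₘ)) k k<m

      st≡ : ∀ i → st β i ≡ st γ i
      st≡ zero with often 0
      ... | m , _ , n , γₙ≡βₘ =
        cong FinSeq.first (forest-prefix-unique forest β γ β-exec γ-exec m n (sym γₙ≡βₘ))
      st≡ (suc i) = proj₂ (agrees i)

  extCount-cong : ∀ β γ → (∀ i → ac β i ≡ ac γ i) → ∀ i → extCount A β i ≡ extCount A γ i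
  extCount-cong β γ ac≡ zero    = refl
  extCount-cong β γ ac≡ (suc i) = cong₂ _+_ (cong (isExt A) (ac≡ i)) (extCount-cong β γ ac≡ i)

  isTraceOf-≋ : ∀ β γ t → β ≋ γ → IsTraceOf A γ t → IsTraceOf A β t
  isTraceOf-≋ β γ t (_ , ac≡) γ-trace k e = mk⇔
    (λ tₖ≡e → let (i , aᵢ≡e , cᵢ≡k) = Equivalence.to (γ-trace k e) tₖ≡e
              in i , trans (ac≡ i) aᵢ≡e , trans (extCount≡ i) cᵢ≡k)
    (λ (i , aᵢ≡e , cᵢ≡k) →
       Equivalence.from (γ-trace k e) (i , trans (sym (ac≡ i)) aᵢ≡e , trans (sym (extCount≡ i)) cᵢ≡k))
    where
      extCount≡ : ∀ i → extCount A β i ≡ extCount A γ i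
      extCount≡ = extCount-cong β γ ac≡

  module _ (φ : InfSeq A → Set) where

    -- φ need not respect _≋_, so membership is tested up to _≋_.
    ≋-Closure : InfSeq A → Set
    ≋-Closure β = Σ (InfSeq A) λ γ → φ γ × γ ≋ β

    -- G is constant so that an execution violating its own pair need not be
    -- decided out of φ: satisfying it produces a witness of ≋-Closure.
    VisitPairs : CPair A → Set
    VisitPairs p = Σ (InfSeq A) λ β → IsInfExec A β ×
      (∀ s → R p s → Visits β s) × (≋-Closure β → ∀ s → G p s)

    ∈φ⇒satAll : IsForest A → (∀ β → φ β → IsInfExec A β) →
      ∀ β → φ β → SatAll A β VisitPairs
    ∈φ⇒satAll forest φ⊆execs β β∈φ p (γ , γ-exec , R⊆γ , G-if-γ∈φ) R-often n =
      n , ≤-refl , G-if-γ∈φ (β , β∈φ , β≋γ) _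
      where
        β≋γ : β ≋ γ
        β≋γ = forest-≋ forest β γ (φ⊆execs β β∈φ) γ-exec
                (λ m → let (j , m≤j , Rⱼ) = R-often m in j , m≤j , R⊆γ _ Rⱼ)

    satAll⇒∈≋-Closure : ∀ β → IsInfExec A β → SatAll A β VisitPairs → ≋-Closure β
    satAll⇒∈≋-Closure β β-exec sat =
      proj₂ (proj₂ (sat ownPair (β , β-exec , (λ _ visits → visits) , (λ β∈ _ → β∈))
                        (λ n → n , ≤-refl , n , refl) 0))
      where
        ownPair : CPair A
        ownPair = record { R = Visits β ; G = λ _ → ≋-Closure β }

corollary18 : (A : Automaton) → IsForest A → (ψ : Trace A → Set) → IsLiveTraceProp A ψ →
    Σ (CPair A → Set) λ L → IsLiveAutomaton A L × (∀ t → traces₁ A (lexecs A L) t ⇔ ψ t)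
corollary18 A forest ψ (φ , (φ⊆execs , φ-live) , ψ⇔tracesφ) =
  VisitPairs A φ , live , λ t → mk⇔ (lexecs⇒ψ t) (ψ⇒lexecs t)
  where
    satAll : ∀ β → φ β → SatAll A β (VisitPairs A φ)
    satAll = ∈φ⇒satAll A φ forest φ⊆execs

    live : IsLiveAutomaton A (VisitPairs A φ)
    live α α-exec =
      let (β , β∈φ , α≺β) = φ-live α α-exec
      in β , φ⊆execs β β∈φ , α≺β , satAll β β∈φ

    lexecs⇒ψ : ∀ t → traces₁ A (lexecs A (VisitPairs A φ)) t → ψ t
    lexecs⇒ψ t (β , (β-exec , sat) , β-trace) =
      let (γ , γ∈φ , γ≋β) = satAll⇒∈≋-Closure A φ β β-exec sat
      in Equivalence.from (ψ⇔tracesφ t) (γ , γ∈φ , isTraceOf-≋ A γ β t γ≋β β-trace)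

    ψ⇒lexecs : ∀ t → ψ t → traces₁ A (lexecs A (VisitPairs A φ)) t
    ψ⇒lexecs t ψt =
      let (β , β∈φ , β-trace) = Equivalence.to (ψ⇔tracesφ t) ψt
      in β , (φ⊆execs β β∈φ , satAll β β∈φ) , β-trace
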